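{- There is an ESO formula $\phi$ of the form $\exists F\forall x\exists y\,\psi$, with $F$ a binary second-order variable and $\psi$ quantifier-free over the vocabulary $\{E\}$, such that for every basic graph $B$: $B\models\phi$ if and only if every connected component of $B$ contains a cycle of even length.
   Context: A basic graph is a finite undirected graph without self-loops, viewed as a structure with a symmetric irreflexive binary relation $E$. A cycle has length at least $3$ and consists of distinct vertices. (In the paper's notation: $A_2\in\mathrm{FD}_{\mathrm{basic}}(E_2ae)$.) -}

module Defs where

open import Data.Nat using (ℕ; zero; suc; _≤_)
open import Data.Nat.Divisibility using (_∣_)
open import Data.Fin using (Fin; zero; suc; inject₁; fromℕ)
open import Data.Bool using (Bool; true; false; _∧_; _∨_; not)
open import Data.Fin.Properties using (_≟_)
open import Data.Product using (Σ; _×_; _,_)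
open import Function.Definitions using (Injective)
open import Relation.Binary.PropositionalEquality using (_≡_)
open import Relation.Nullary.Decidable using (⌊_⌋)

Rel₂ : ℕ → Set
Rel₂ n = Fin n → Fin n → Bool

record IsBasic {n : ℕ} (E : Rel₂ n) : Set where
  field
    sym   : ∀ u v → E u v ≡ E v u
    irrefl : ∀ u → E u u ≡ false

data Var : Set where
  x y : Var

data QF : Set where
  atomE  : Var → Var → QF
  atomF  : Var → Var → QF
  atomEq : Var → Var → QF
  ⊤f ⊥f  : QF
  ¬f_    : QF → QF
  _∧f_   : QF → QF → QF
  _∨f_   : QF → QF → QF

evalQF : {n : ℕ} → Rel₂ n → Rel₂ n → Fin n → Fin n → QF → Bool
evalQF {n} E F a b = go
  where
  val : Var → Fin n
  val x = a
  val y = b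
  go : QF → Bool
  go (atomE s t)  = E (val s) (val t)
  go (atomF s t)  = F (val s) (val t)
  go (atomEq s t) = ⌊ val s ≟ val t ⌋
  go ⊤f = true
  go ⊥f = false
  go (¬f φ) = not (go φ)
  go (φ ∧f ψ) = go φ ∧ go ψ
  go (φ ∨f ψ) = go φ ∨ go ψ

SatESO : QF → (n : ℕ) → Rel₂ n → Set
SatESO ψ n E =
  Σ (Rel₂ n) λ F → (a : Fin n) → Σ (Fin n) λ b → evalQF E F a b ψ ≡ true

data Reach {n : ℕ} (E : Rel₂ n) : Fin n → Fin n → Set where
  here : ∀ {u} → Reach E u u
  step : ∀ {u w v} → E u w ≡ true → Reach E w v → Reach E u v

record Cycle {n : ℕ} (E : Rel₂ n) : Set where
  field
    m        : ℕ
    verts    : Fin (suc m) → Fin n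
    long     : 3 ≤ suc m
    distinct : Injective _≡_ _≡_ verts
    edges    : ∀ (i : Fin m) → E (verts (inject₁ i)) (verts (suc i)) ≡ true
    closing  : E (verts (fromℕ m)) (verts zero) ≡ true

  len : ℕ
  len = suc m

EvenCycle : {n : ℕ} → Rel₂ n → Set
EvenCycle E = Σ (Cycle E) λ c → 2 ∣ Cycle.len c

CycleInComponentOf : {n : ℕ} (E : Rel₂ n) → Fin n → Cycle E → Set
CycleInComponentOf E u c = ∀ i → Reach E u (Cycle.verts c i)

-- Every connected component contains a cycle of even length
-- (each component is the component of some vertex u).
EveryComponentHasEvenCycle : (n : ℕ) → Rel₂ n → Set
EveryComponentHasEvenCycle n E =
  (u : Fin n) → Σ (Cycle E) λ c → (2 ∣ Cycle.len c) × CycleInComponentOf E u c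

-- Read F as a pair (next, colour): off the diagonal F is the graph of a successor function
-- next, on the diagonal it is a 2-colouring, and ψ says that next a is a neighbour of a of the
-- opposite colour with next (next a) ≢ a.  Iterating next from any vertex u eventually enters
-- a periodic orbit; its minimal period traces a cycle in the component of u, of length at
-- least 3 because next has no fixed points and no 2-cycles, and even because the colours
-- alternate along it.  Conversely, build (next, colour) greedily on a growing set S of handled
-- vertices: a vertex outside S with a neighbour in S points to that neighbour and takes the
-- opposite colour; if there is no such vertex, the component of any vertex outside S misses S
-- entirely, and its even cycle, coloured alternately, is added whole.

module Submission where

open import Defs
open import Data.Bool using (Bool; true; false; not; _∧_; _∨_; if_then_else_)
open import Data.Bool.Properties using (not-involutive; not-¬) renaming (_≟_ to _≟ᴮ_)
open import Data.Empty using (⊥-elim)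
open import Data.Fin using (Fin; zero; suc; toℕ; inject₁; fromℕ)
open import Data.Fin.Properties
  using (_≟_; any?; all?; ¬∀⟶∃¬; pigeonhole; toℕ-injective; toℕ-inject₁; toℕ-fromℕ; toℕ≤pred[n])
open import Data.Fin.Relation.Unary.Top using (view; ‵fromℕ; ‵inject₁)
open import Data.Fin.Subset using (Subset; _∈_; _∉_; _∪_; _⊂_; _⊃_; ⁅_⁆) renaming (⊥ to ∅)
open import Data.Fin.Subset.Properties using (_∈?_; x∈p∪q⁻; p⊆p∪q; q⊆p∪q; x∈⁅x⁆; x∈⁅y⁆⇒x≡y; ∉⊥)
open import Data.Fin.Subset.Induction using (⊃-wellFounded)
open import Data.Nat using (ℕ; zero; suc; _+_; _*_; _∸_; _<_; _≤_; z≤n; s≤s)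
open import Data.Nat.Divisibility using (_∣_; divides; _∣0; ∣-refl; ∣m∣n⇒∣m+n)
open import Data.Nat.Induction using (<-wellFounded)
open import Data.Nat.Properties
  using (anyUpTo?; <-cmp; n<1+n; +-suc; m∸n+n≡m; +-monoʳ-<; <-≤-trans; ≤-reflexive; ≤-pred)
open import Data.Product using (Σ; ∃; ∃₂; _×_; _,_; proj₁; proj₂)
open import Data.Sum using (_⊎_; inj₁; inj₂)
open import Data.Vec using (tabulate)
open import Data.Vec.Properties using ([]=⇒lookup; lookup⇒[]=; lookup∘tabulate)
open import Data.Vec.Functional using (updateAt)
open import Data.Vec.Functional.Properties using (updateAt-updates; updateAt-minimal)
import Function.Endo.Propositional as Endo
open import Function using (_∘_; id; const; _⇔_; mk⇔; Equivalence)
open import Function.Definitions using (Injective)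
open import Induction.WellFounded using (Acc; acc)
open import Relation.Binary.Definitions using (tri<; tri≈; tri>)
open import Relation.Binary.PropositionalEquality
open import Relation.Nullary using (¬_; Dec; yes; no; does; ¬?; _×-dec_)
open import Relation.Nullary.Decidable using (dec-true; dec-false)
open import Relation.Unary using (Pred; Decidable)

module _ {A : Set} where
  open Endo A public using (_^_; ^-homo)

^-+ : {A : Set} (f : A → A) (m n : ℕ) (a : A) → (f ^ (m + n)) a ≡ (f ^ m) ((f ^ n) a)
^-+ f m n = cong-app (^-homo f m n)

not-^-even : ∀ {k} → 2 ∣ k → ∀ b → (not ^ k) b ≡ b
not-^-even (divides q refl) b = go q
  where
  go : ∀ q → (not ^ (q * 2)) b ≡ b
  go zero    = refl
  go (suc q) = trans (not-involutive _) (go q)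

not-^-fixed⇒even : ∀ k b → (not ^ k) b ≡ b → 2 ∣ k
not-^-fixed⇒even zero          b _  = 2 ∣0
not-^-fixed⇒even (suc zero)    b eq = ⊥-elim (not-¬ refl (sym eq))
not-^-fixed⇒even (suc (suc k)) b eq =
  ∣m∣n⇒∣m+n ∣-refl (not-^-fixed⇒even k b (trans (sym (not-involutive _)) eq))

least-witness : ∀ {p} {P : Pred ℕ p} → Decidable P → ∀ k → P k →
                ∃ λ m → P m × (∀ {j} → j < m → ¬ P j)
least-witness {P = P} P? k = go k (<-wellFounded k)
  where
  go : ∀ k → Acc _<_ k → P k → ∃ λ m → P m × (∀ {j} → j < m → ¬ P j)
  go k (acc smaller) pk with anyUpTo? P? k
  ... | yes (j , j<k , pj) = go j (smaller j<k) pj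
  ... | no none            = k , pk , λ j<k pj → none (_ , j<k , pj)

module Orbit {n : ℕ} (f : Fin n → Fin n) where

  record MinimalPeriod (k : ℕ) (v : Fin n) : Set where
    field
      periodic : (f ^ suc k) v ≡ v
      minimal  : ∀ {j} → j < k → (f ^ suc j) v ≢ v

  eventually-periodic : ∀ u → ∃₂ λ a k → (f ^ suc k) ((f ^ a) u) ≡ (f ^ a) u
  eventually-periodic u with pigeonhole (n<1+n n) (λ i → (f ^ toℕ i) u)
  ... | i , j , i<j , fⁱu≡fʲu = a , t , (begin
    (f ^ suc t) ((f ^ a) u)  ≡⟨ ^-+ f (suc t) a u ⟨
    (f ^ suc (t + a)) u      ≡⟨ cong (λ e → (f ^ e) u) (trans (sym (+-suc t a)) (m∸n+n≡m i<j)) ⟩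
    (f ^ toℕ j) u            ≡⟨ fⁱu≡fʲu ⟨
    (f ^ a) u                ∎)
    where
    open ≡-Reasoning
    a = toℕ i
    t = toℕ j ∸ suc a

  minimal-period : ∀ {v} k → (f ^ suc k) v ≡ v → ∃ λ k → MinimalPeriod k v
  minimal-period {v} k periodic
    with least-witness {P = λ k → (f ^ suc k) v ≡ v} (λ k → (f ^ suc k) v ≟ v) k periodic
  ... | k , fᵏv≡v , minimal = k , record { periodic = fᵏv≡v ; minimal = minimal }

  module _ {k v} (mp : MinimalPeriod k v) where
    open MinimalPeriod mp

    no-early-return : ∀ {a b} → a < b → b ≤ k → (f ^ a) v ≢ (f ^ b) v
    no-early-return {a} {b} a<b b≤k fᵃv≡fᵇv = minimal r+a<k returns
      where
      open ≡-Reasoning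
      r = k ∸ b
      r+a<k : r + a < k
      r+a<k = <-≤-trans (+-monoʳ-< r a<b) (≤-reflexive (m∸n+n≡m b≤k))
      returns : (f ^ suc (r + a)) v ≡ v
      returns = begin
        (f ^ (suc r + a)) v      ≡⟨ ^-+ f (suc r) a v ⟩
        (f ^ suc r) ((f ^ a) v)  ≡⟨ cong (f ^ suc r) fᵃv≡fᵇv ⟩
        (f ^ suc r) ((f ^ b) v)  ≡⟨ ^-+ f (suc r) b v ⟨
        (f ^ suc (r + b)) v      ≡⟨ cong (λ e → (f ^ suc e) v) (m∸n+n≡m b≤k) ⟩
        (f ^ suc k) v            ≡⟨ periodic ⟩
        v                        ∎

    orbit-injective : ∀ {a b} → a ≤ k → b ≤ k → (f ^ a) v ≡ (f ^ b) v → a ≡ b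
    orbit-injective {a} {b} a≤k b≤k fᵃv≡fᵇv with <-cmp a b
    ... | tri< a<b _ _ = ⊥-elim (no-early-return a<b b≤k fᵃv≡fᵇv)
    ... | tri≈ _ a≡b _ = a≡b
    ... | tri> _ _ b<a = ⊥-elim (no-early-return b<a a≤k (sym fᵃv≡fᵇv))

reach-snoc : ∀ {n} {E : Rel₂ n} {u w v} → Reach E u w → E w v ≡ true → Reach E u v
reach-snoc here         Ewv = step Ewv here
reach-snoc (step Euw r) Ewv = step Euw (reach-snoc r Ewv)

record AlternatingAt {n : ℕ} (E : Rel₂ n) (next : Fin n → Fin n) (colour : Fin n → Bool)
                     (a : Fin n) : Set where
  field
    edge      : E a (next a) ≡ true
    no-return : next (next a) ≢ a
    flips     : colour (next a) ≡ not (colour a)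

  next≢id : next a ≢ a
  next≢id eq = not-¬ refl (subst (λ b → colour b ≡ not (colour a)) eq flips)

record AlternatingSuccessor {n : ℕ} (E : Rel₂ n) : Set where
  field
    next        : Fin n → Fin n
    colour      : Fin n → Bool
    alternating : ∀ a → AlternatingAt E next colour a

ψ : QF
ψ = atomF x y ∧f (atomE x y ∧f ((¬f atomF y x) ∧f colourChanges))
  where
  colourChanges : QF
  colourChanges = (atomF x x ∧f (¬f atomF y y)) ∨f ((¬f atomF x x) ∧f atomF y y)

ψ-holds⇔ : ∀ {n} (E F : Rel₂ n) a b → evalQF E F a b ψ ≡ true ⇔
           (F a b ≡ true × E a b ≡ true × F b a ≡ false × F b b ≡ not (F a a))
ψ-holds⇔ E F a b = mk⇔ (to (F a b) (E a b) (F b a) (F a a) (F b b))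
                       (from (F a b) (E a b) (F b a) (F a a) (F b b))
  where
  to : ∀ fab eab fba faa fbb →
       fab ∧ (eab ∧ (not fba ∧ ((faa ∧ not fbb) ∨ (not faa ∧ fbb)))) ≡ true →
       fab ≡ true × eab ≡ true × fba ≡ false × fbb ≡ not faa
  to true  true  false true  false _ = refl , refl , refl , refl
  to true  true  false false true  _ = refl , refl , refl , refl
  to false _     _     _     _     ()
  to true  false _     _     _     ()
  to true  true  true  _     _     ()
  to true  true  false true  true  ()
  to true  true  false false false ()
  from : ∀ fab eab fba faa fbb → fab ≡ true × eab ≡ true × fba ≡ false × fbb ≡ not faa →
         fab ∧ (eab ∧ (not fba ∧ ((faa ∧ not fbb) ∨ (not faa ∧ fbb)))) ≡ true
  from _ _ _ true  _ (refl , refl , refl , refl) = refl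
  from _ _ _ false _ (refl , refl , refl , refl) = refl

sat⇒alternating : ∀ {n} {E : Rel₂ n} → SatESO ψ n E → AlternatingSuccessor E
sat⇒alternating {n} {E} (F , sat) = record
  { next = next ; colour = colour ; alternating = alternating }
  where
  next : Fin n → Fin n
  next a = proj₁ (sat a)
  colour : Fin n → Bool
  colour a = F a a
  holds : ∀ a → F a (next a) ≡ true × E a (next a) ≡ true ×
                F (next a) a ≡ false × colour (next a) ≡ not (colour a)
  holds a = Equivalence.to (ψ-holds⇔ E F a (next a)) (proj₂ (sat a))
  true≢false : true ≢ false
  true≢false ()
  alternating : ∀ a → AlternatingAt E next colour a
  alternating a
    with Fa′a″ , _ , _ , _ ← holds (next a) | _ , Eaa′ , Fa′a , flips ← holds a = record
    { edge      = Eaa′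
    ; no-return = λ a″≡a → true≢false (trans (sym Fa′a″) (trans (cong (F (next a)) a″≡a) Fa′a))
    ; flips     = flips
    }

alternating⇒sat : ∀ {n} {E : Rel₂ n} → AlternatingSuccessor E → SatESO ψ n E
alternating⇒sat {n} {E} S =
  F , λ a → next a , Equivalence.from (ψ-holds⇔ E F a (next a)) (holds a)
  where
  open AlternatingSuccessor S
  F : Rel₂ n
  F a b = if does (a ≟ b) then colour a else does (b ≟ next a)
  F-diag : ∀ a → F a a ≡ colour a
  F-diag a rewrite dec-true (a ≟ a) refl = refl
  F-off : ∀ {a b} → a ≢ b → F a b ≡ does (b ≟ next a)
  F-off {a} {b} a≢b rewrite dec-false (a ≟ b) a≢b = refl
  holds : ∀ a → F a (next a) ≡ true × E a (next a) ≡ true ×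
                F (next a) a ≡ false × F (next a) (next a) ≡ not (F a a)
  holds a = trans (F-off (next≢id ∘ sym)) (dec-true (next a ≟ next a) refl)
          , edge
          , trans (F-off next≢id) (dec-false (a ≟ next (next a)) (no-return ∘ sym))
          , trans (F-diag (next a)) (trans flips (cong not (sym (F-diag a))))
    where open AlternatingAt (alternating a)

module _ {n : ℕ} {E : Rel₂ n} (S : AlternatingSuccessor E) where
  open AlternatingSuccessor S
  open module Alternating a = AlternatingAt (alternating a)
  open Orbit next

  reach-^ : ∀ k a → Reach E a ((next ^ k) a)
  reach-^ zero    a = here
  reach-^ (suc k) a = reach-snoc (reach-^ k a) (edge _)

  colour-^ : ∀ k a → colour ((next ^ k) a) ≡ (not ^ k) (colour a)
  colour-^ zero    a = refl
  colour-^ (suc k) a = trans (flips _) (cong not (colour-^ k a))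

  minimal-period≥3 : ∀ {k v} → MinimalPeriod k v → 3 ≤ suc k
  minimal-period≥3 {zero}        {v} mp = ⊥-elim (next≢id v (MinimalPeriod.periodic mp))
  minimal-period≥3 {suc zero}    {v} mp = ⊥-elim (no-return v (MinimalPeriod.periodic mp))
  minimal-period≥3 {suc (suc k)}     _  = s≤s (s≤s (s≤s z≤n))

  orbit-cycle : ∀ {k v} → MinimalPeriod k v → Cycle E
  orbit-cycle {k} {v} mp = record
    { m        = k
    ; verts    = λ i → (next ^ toℕ i) v
    ; long     = minimal-period≥3 mp
    ; distinct = λ {i} {j} eq →
        toℕ-injective (orbit-injective mp (toℕ≤pred[n] i) (toℕ≤pred[n] j) eq)
    ; edges    = edges
    ; closing  = closing
    }
    where
    edges : ∀ i → E ((next ^ toℕ (inject₁ i)) v) ((next ^ suc (toℕ i)) v) ≡ true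
    edges i rewrite toℕ-inject₁ i = edge _
    closing : E ((next ^ toℕ (fromℕ k)) v) v ≡ true
    closing rewrite toℕ-fromℕ k =
      subst (λ b → E ((next ^ k) v) b ≡ true) (MinimalPeriod.periodic mp) (edge ((next ^ k) v))

  orbit-cycle-even : ∀ {k v} (mp : MinimalPeriod k v) → 2 ∣ Cycle.len (orbit-cycle mp)
  orbit-cycle-even {k} {v} mp = not-^-fixed⇒even (suc k) (colour v)
    (trans (sym (colour-^ (suc k) v)) (cong colour (MinimalPeriod.periodic mp)))

  alternating⇒evenCycles : EveryComponentHasEvenCycle n E
  alternating⇒evenCycles u with eventually-periodic u
  ... | a , k , periodic with minimal-period k periodic
  ...   | _ , mp = orbit-cycle mp , orbit-cycle-even mp , λ i →
    subst (Reach E u) (^-+ next (toℕ i) a u) (reach-^ (toℕ i + a) u)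

data CyclicStep (m : ℕ) : ℕ → ℕ → Set where
  wrap : CyclicStep m m zero
  up   : ∀ {a} → CyclicStep m a (suc a)

cyclicStep-twice≢ : ∀ {m a b c} → 2 ≤ m → CyclicStep m a b → CyclicStep m b c → c ≢ a
cyclicStep-twice≢ (s≤s (s≤s _)) wrap up   ()
cyclicStep-twice≢ (s≤s (s≤s _)) up   wrap ()
cyclicStep-twice≢ _             up   up   ()

cyclicStep-not-^ : ∀ {m a b} → 2 ∣ suc m → CyclicStep m a b →
                   ∀ c → (not ^ b) c ≡ not ((not ^ a) c)
cyclicStep-not-^ even wrap c = sym (not-^-even even c)
cyclicStep-not-^ even up   c = refl

module Image {k n : ℕ} (g : Fin k → Fin n) where

  locate : ∀ a → Dec (∃ λ i → g i ≡ a)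
  locate a = any? (λ i → g i ≟ a)

  image : Subset n
  image = tabulate (does ∘ locate)

  ∈-image⁺ : ∀ i → g i ∈ image
  ∈-image⁺ i = lookup⇒[]= (g i) image
    (trans (lookup∘tabulate (does ∘ locate) (g i)) (dec-true (locate (g i)) (i , refl)))

  ∈-image⁻ : ∀ {a} → a ∈ image → ∃ λ i → g i ≡ a
  ∈-image⁻ {a} a∈image
    with locate a | trans (sym (lookup∘tabulate (does ∘ locate) a)) ([]=⇒lookup a∈image)
  ... | yes found | _  = found
  ... | no  _     | ()

  extend : {A : Set} → (Fin k → A) → (Fin n → A) → Fin n → A
  extend h f a with locate a
  ... | yes (i , _) = h i
  ... | no _        = f a

  extend-image : Injective _≡_ _≡_ g → ∀ {A : Set} (h : Fin k → A) f i → extend h f (g i) ≡ h i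
  extend-image g-injective h f i with locate (g i)
  ... | yes (j , gj≡gi) = cong h (g-injective gj≡gi)
  ... | no  ∄           = ⊥-elim (∄ (i , refl))

  extend-off : ∀ {A : Set} (h : Fin k → A) f {a} → (∀ i → g i ≢ a) → extend h f a ≡ f a
  extend-off h f {a} off with locate a
  ... | yes (i , gi≡a) = ⊥-elim (off i gi≡a)
  ... | no _           = refl

module CycleSuccessor {n : ℕ} {E : Rel₂ n} (c : Cycle E) where
  open Cycle c

  succ : Fin (suc m) → Fin (suc m)
  succ i with view i
  ... | ‵fromℕ     = zero
  ... | ‵inject₁ j = suc j

  edge-succ : ∀ i → E (verts i) (verts (succ i)) ≡ true
  edge-succ i with view i
  ... | ‵fromℕ     = closing
  ... | ‵inject₁ j = edges j

  cyclicStep-succ : ∀ i → CyclicStep m (toℕ i) (toℕ (succ i))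
  cyclicStep-succ i with view i
  ... | ‵fromℕ     rewrite toℕ-fromℕ m   = wrap
  ... | ‵inject₁ j rewrite toℕ-inject₁ j = up

  succ-succ≢ : ∀ i → succ (succ i) ≢ i
  succ-succ≢ i eq =
    cyclicStep-twice≢ (≤-pred long) (cyclicStep-succ i) (cyclicStep-succ (succ i)) (cong toℕ eq)

p⊂p∪q : ∀ {n} {p q : Subset n} {a} → a ∈ q → a ∉ p → p ⊂ p ∪ q
p⊂p∪q {p = p} {q} {a} a∈q a∉p = p⊆p∪q q , a , q⊆p∪q p q a∈q , a∉p

module Covering {n : ℕ} {E : Rel₂ n} where

  AlternatingOn : Subset n → (Fin n → Fin n) → (Fin n → Bool) → Set
  AlternatingOn S next colour = ∀ {a} → a ∈ S → next a ∈ S × AlternatingAt E next colour a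

  record AlternatingSuccessorOn (S : Subset n) : Set where
    field
      next          : Fin n → Fin n
      colour        : Fin n → Bool
      alternatingOn : AlternatingOn S next colour

  alternatingOn-agree : ∀ {S next colour next′ colour′} → AlternatingOn S next colour →
                        (∀ {a} → a ∈ S → next′ a ≡ next a × colour′ a ≡ colour a) →
                        AlternatingOn S next′ colour′
  alternatingOn-agree {S} {next} {colour} {next′} {colour′} on agree {a} a∈S =
    subst (_∈ S) (sym next′≗) a′∈S , record
    { edge      = subst (λ b → E a b ≡ true) (sym next′≗) edge
    ; no-return = no-return ∘ trans (sym next′²≗)
    ; flips     = begin
        colour′ (next′ a) ≡⟨ cong colour′ next′≗ ⟩
        colour′ (next a)  ≡⟨ proj₂ (agree a′∈S) ⟩
        colour (next a)   ≡⟨ flips ⟩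
        not (colour a)    ≡⟨ cong not (proj₂ (agree a∈S)) ⟨
        not (colour′ a)   ∎
    }
    where
    open ≡-Reasoning
    open AlternatingAt (proj₂ (on a∈S))
    a′∈S = proj₁ (on a∈S)
    next′≗ : next′ a ≡ next a
    next′≗ = proj₁ (agree a∈S)
    next′²≗ : next′ (next′ a) ≡ next (next a)
    next′²≗ = trans (cong next′ next′≗) (proj₁ (agree a′∈S))

  alternatingOn-∪ : ∀ {S T next colour} → AlternatingOn S next colour →
                    (∀ {a} → a ∈ T → next a ∈ S ∪ T × AlternatingAt E next colour a) →
                    AlternatingOn (S ∪ T) next colour
  alternatingOn-∪ {S} {T} onS onT a∈S∪T with x∈p∪q⁻ S T a∈S∪T
  ... | inj₁ a∈S = p⊆p∪q T (proj₁ (onS a∈S)) , proj₂ (onS a∈S)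
  ... | inj₂ a∈T = onT a∈T

  attach : ∀ {S u w} → AlternatingSuccessorOn S → u ∉ S → w ∈ S → E u w ≡ true →
           AlternatingSuccessorOn (S ∪ ⁅ u ⁆)
  attach {S} {u} {w} P u∉S w∈S Euw = record
    { next          = next′
    ; colour        = colour′
    ; alternatingOn = alternatingOn-∪ (alternatingOn-agree alternatingOn agree) at-u
    }
    where
    open AlternatingSuccessorOn P
    next′ = updateAt next u (const w)
    colour′ = updateAt colour u (const (not (colour w)))
    agree : ∀ {a} → a ∈ S → next′ a ≡ next a × colour′ a ≡ colour a
    agree {a} a∈S = updateAt-minimal a u next a≢u , updateAt-minimal a u colour a≢u
      where
      a≢u : a ≢ u
      a≢u refl = u∉S a∈S
    next′-u : next′ u ≡ w
    next′-u = updateAt-updates u next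
    at-u : ∀ {a} → a ∈ ⁅ u ⁆ → next′ a ∈ S ∪ ⁅ u ⁆ × AlternatingAt E next′ colour′ a
    at-u a∈⁅u⁆ with refl ← x∈⁅y⁆⇒x≡y u a∈⁅u⁆ =
      subst (_∈ S ∪ ⁅ u ⁆) (sym next′-u) (p⊆p∪q ⁅ u ⁆ w∈S) , record
      { edge      = subst (λ b → E u b ≡ true) (sym next′-u) Euw
      ; no-return = λ eq → u∉S (subst (_∈ S) (trans (sym next′²-u) eq) (proj₁ (alternatingOn w∈S)))
      ; flips     = begin
          colour′ (next′ u)    ≡⟨ cong colour′ next′-u ⟩
          colour′ w            ≡⟨ proj₂ (agree w∈S) ⟩
          colour w             ≡⟨ not-involutive (colour w) ⟨
          not (not (colour w)) ≡⟨ cong not (updateAt-updates u colour) ⟨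
          not (colour′ u)      ∎
      }
      where
      open ≡-Reasoning
      next′²-u : next′ (next′ u) ≡ next w
      next′²-u = trans (cong next′ next′-u) (proj₁ (agree w∈S))

  add-cycle : ∀ {S} → AlternatingSuccessorOn S → (c : Cycle E) → 2 ∣ Cycle.len c →
              (∀ i → Cycle.verts c i ∉ S) →
              AlternatingSuccessorOn (S ∪ Image.image (Cycle.verts c))
  add-cycle {S} P c even off = record
    { next          = next′
    ; colour        = colour′
    ; alternatingOn = alternatingOn-∪ (alternatingOn-agree alternatingOn agree) on-cycle
    }
    where
    open AlternatingSuccessorOn P
    open Cycle c using (verts; distinct)
    open CycleSuccessor c
    open Image verts
    parity : Fin (Cycle.len c) → Bool
    parity i = (not ^ toℕ i) false
    next′ = extend (verts ∘ succ) next
    colour′ = extend parity colour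
    agree : ∀ {a} → a ∈ S → next′ a ≡ next a × colour′ a ≡ colour a
    agree {a} a∈S = extend-off (verts ∘ succ) next off′ , extend-off parity colour off′
      where
      off′ : ∀ i → verts i ≢ a
      off′ i refl = off i a∈S
    next′-verts : ∀ i → next′ (verts i) ≡ verts (succ i)
    next′-verts = extend-image distinct (verts ∘ succ) next
    colour′-verts : ∀ i → colour′ (verts i) ≡ parity i
    colour′-verts = extend-image distinct parity colour
    on-cycle : ∀ {a} → a ∈ image → next′ a ∈ S ∪ image × AlternatingAt E next′ colour′ a
    on-cycle a∈image with i , refl ← ∈-image⁻ a∈image =
      subst (_∈ S ∪ image) (sym (next′-verts i)) (q⊆p∪q S image (∈-image⁺ (succ i))) , record
      { edge      = subst (λ b → E (verts i) b ≡ true) (sym (next′-verts i)) (edge-succ i)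
      ; no-return = λ eq → succ-succ≢ i (distinct (trans (sym next′²) eq))
      ; flips     = begin
          colour′ (next′ (verts i)) ≡⟨ cong colour′ (next′-verts i) ⟩
          colour′ (verts (succ i))  ≡⟨ colour′-verts (succ i) ⟩
          parity (succ i)           ≡⟨ cyclicStep-not-^ even (cyclicStep-succ i) false ⟩
          not (parity i)            ≡⟨ cong not (colour′-verts i) ⟨
          not (colour′ (verts i))   ∎
      }
      where
      open ≡-Reasoning
      next′² : next′ (next′ (verts i)) ≡ verts (succ (succ i))
      next′² = trans (cong next′ (next′-verts i)) (next′-verts (succ i))

  reach-∉ : ∀ {S u v} → (∀ {a b} → a ∉ S → b ∈ S → E a b ≢ true) →
            Reach E u v → u ∉ S → v ∉ S
  reach-∉ no-crossing here         u∉S = u∉S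
  reach-∉ no-crossing (step Euw r) u∉S =
    reach-∉ no-crossing r (λ w∈S → no-crossing u∉S w∈S Euw)

  grow : EveryComponentHasEvenCycle n E → ∀ {S} → AlternatingSuccessorOn S →
         (∀ a → a ∈ S) ⊎ ∃ λ S′ → S ⊂ S′ × AlternatingSuccessorOn S′
  grow H {S} P with all? (_∈? S)
  ... | yes all = inj₁ all
  ... | no ¬all with u , u∉S ← ¬∀⟶∃¬ n (_∈ S) (_∈? S) ¬all
    with any? (λ a → any? (λ b → (¬? (a ∈? S) ×-dec b ∈? S) ×-dec E a b ≟ᴮ true))
  ... | yes (a , b , (a∉S , b∈S) , Eab) =
    inj₂ (_ , p⊂p∪q (x∈⁅x⁆ a) a∉S , attach P a∉S b∈S Eab)
  ... | no ∄crossing with c , even , inComponent ← H u =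
    inj₂ (_ , p⊂p∪q (Image.∈-image⁺ (Cycle.verts c) zero) (off zero) , add-cycle P c even off)
    where
    off : ∀ i → Cycle.verts c i ∉ S
    off i = reach-∉ (λ a∉S b∈S Eab → ∄crossing (_ , _ , (a∉S , b∈S) , Eab)) (inComponent i) u∉S

  complete : EveryComponentHasEvenCycle n E →
             ∀ {S} → Acc _⊃_ S → AlternatingSuccessorOn S → AlternatingSuccessor E
  complete H (acc larger) P with grow H P
  ... | inj₁ all = record
    { next = next ; colour = colour ; alternating = proj₂ ∘ alternatingOn ∘ all }
    where open AlternatingSuccessorOn P
  ... | inj₂ (_ , S⊂S′ , P′) = complete H (larger S⊂S′) P′

  evenCycles⇒alternating : EveryComponentHasEvenCycle n E → AlternatingSuccessor E
  evenCycles⇒alternating H = complete H (⊃-wellFounded ∅) record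
    { next = id ; colour = const false ; alternatingOn = ⊥-elim ∘ ∉⊥ }

open Covering using (evenCycles⇒alternating)

lemma3 : Σ QF λ ψ → (n : ℕ) (E : Rel₂ n) → IsBasic E →
           (SatESO ψ n E ⇔ EveryComponentHasEvenCycle n E)
lemma3 = ψ , λ n E _ → mk⇔ (alternating⇒evenCycles ∘ sat⇒alternating)
                           (alternating⇒sat ∘ evenCycles⇒alternating)
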